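{- Let $i$, $j$ and $k$ be positive integers with $i \leq j$ and $k > i+j$. Let $G$ be a graph that contains a clique $K$ on $k$ vertices, with vertex set $V_K$. Then for every $(i,j)$-factor cut $(V_1,V_2)$ of $G$, either $V_K \subseteq V_1$ or $V_K \subseteq V_2$.
   Context: Graphs are finite, undirected, without multiple edges. For a graph $G=(V_G,E_G)$, a vertex $v$ and an edge set $E\subseteq E_G$, $d_E(v)$ denotes the number of edges of $E$ incident with $v$. For a partition $(V_1,V_2)$ of $V_G$, $E_G(V_1,V_2)$ denotes the set of edges of $G$ with one end in $V_1$ and the other in $V_2$. For positive integers $i\le j$, a partition $(V_1,V_2)$ of $V_G$ with $M=E_G(V_1,V_2)$ is an $(i,j)$-factor cut of $G$ if $d_M(v)\le i$ for all $v\in V_1$ and $d_M(v)\le j$ for all $v\in V_2$. A clique is a set of pairwise adjacent vertices. -}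

module Defs where

open import Data.Nat using (ℕ; zero; suc; _+_; _≤_)
open import Data.Bool using (Bool; true; false; _∧_; _xor_; if_then_else_)
open import Data.Fin using (Fin)
open import Data.List using (List; map)
open import Data.Nat.ListAction using (sum)
open import Data.Product using (_×_)
open import Data.List using (allFin)
open import Relation.Binary.PropositionalEquality using (_≡_; _≢_)

record Graph (n : ℕ) : Set where
  field
    adj   : Fin n → Fin n → Bool
    sym   : ∀ u v → adj u v ≡ adj v u
    irrefl : ∀ v → adj v v ≡ false

open Graph public

Partition : ℕ → Set
Partition n = Fin n → Bool

InV₁ : ∀ {n} → Partition n → Fin n → Set
InV₁ p v = p v ≡ false

InV₂ : ∀ {n} → Partition n → Fin n → Set
InV₂ p v = p v ≡ true

cutDeg : ∀ {n} → Graph n → Partition n → Fin n → ℕ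
cutDeg G p v =
  sum (map (λ u → if adj G v u ∧ (p u xor p v) then 1 else 0) (allFin _))

IsFactorCut : ∀ {n} → ℕ → ℕ → Graph n → Partition n → Set
IsFactorCut i j G p =
  (∀ v → InV₁ p v → cutDeg G p v ≤ i) × (∀ v → InV₂ p v → cutDeg G p v ≤ j)

record Clique {n : ℕ} (G : Graph n) (k : ℕ) : Set where
  field
    vert     : Fin k → Fin n
    injective : ∀ a b → vert a ≡ vert b → a ≡ b
    pairwise : ∀ a b → a ≢ b → adj G (vert a) (vert b) ≡ true

open Clique public

-- If a clique K meets both sides of a cut, pick a ∈ V₁ and b ∈ V₂ in K.  Every
-- vertex c of K lies on the side opposite to a or to b and is then adjacent to
-- it, so c contributes a cut edge at a or at b.  Hence
-- k ≤ d_M(a) + d_M(b) ≤ i + j, contradicting k > i + j.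
module Submission where

open import Defs hiding (sym)
open import Data.Bool using (Bool; true; false; _∧_; _xor_; if_then_else_)
open import Data.Bool.Properties using (_≟_; ¬-not; not-¬)
open import Data.Fin using (Fin; zero; suc; punchOut)
open import Data.Fin.Properties using (all?; ¬∀⟶∃¬; punchOut-injective; suc-injective)
open import Data.List using (map; tabulate; allFin)
open import Data.List.Properties using (map-tabulate)
import Data.Nat.ListAction as List
open import Data.Nat using (ℕ; zero; suc; _+_; _≤_; _<_; z≤n)
open import Data.Nat.Properties
  using (+-0-commutativeMonoid; +-mono-≤; +-monoʳ-≤; m≤m+n; m≤n+m; ≤-trans; ≤-reflexive; <⇒≱; module ≤-Reasoning)
open import Algebra.Properties.CommutativeMonoid.Sum +-0-commutativeMonoid
  using (sum; sum-cong-≗; sum-remove; ∑-distrib-+)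
open import Data.Product using (Σ-syntax; _×_; _,_)
open import Data.Sum using (_⊎_; inj₁; inj₂)
open import Data.Vec.Functional using (Vector; removeAt)
open import Data.Vec.Functional.Properties using (removeAt-punchOut)
open import Function using (_∘_)
open import Function.Definitions using (Injective)
open import Relation.Binary.PropositionalEquality
open import Relation.Nullary using (yes; no; contradiction)

private
  variable
    k n : ℕ

sum-ones : ∀ n → sum {n} (λ _ → 1) ≡ n
sum-ones zero    = refl
sum-ones (suc n) = cong suc (sum-ones n)

sum-mono-≤ : {f g : Vector ℕ n} → (∀ u → f u ≤ g u) → sum f ≤ sum g
sum-mono-≤ {zero}  f≤g = z≤n
sum-mono-≤ {suc n} f≤g = +-mono-≤ (f≤g zero) (sum-mono-≤ (f≤g ∘ suc))

sum-map-allFin : (f : Fin n → ℕ) → List.sum (map f (allFin n)) ≡ sum f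
sum-map-allFin f = trans (cong List.sum (map-tabulate (λ u → u) f)) (sum-tabulate f)
  where
  sum-tabulate : ∀ {m} (g : Fin m → ℕ) → List.sum (tabulate g) ≡ sum g
  sum-tabulate {zero}  g = refl
  sum-tabulate {suc m} g = cong (g zero +_) (sum-tabulate (g ∘ suc))

sum-∘-injective-≤ : (f : Vector ℕ n) (h : Fin k → Fin n) → Injective _≡_ _≡_ h →
                    sum (f ∘ h) ≤ sum f
sum-∘-injective-≤ {k = zero}  f h h-inj = z≤n
sum-∘-injective-≤ {n = zero} {k = suc k} f h h-inj with () ← h zero
sum-∘-injective-≤ {n = suc n} {k = suc k} f h h-inj = begin
  f (h zero) + sum (f ∘ h ∘ suc)                ≡⟨ cong (f (h zero) +_) (sum-cong-≗ reindex) ⟩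
  f (h zero) + sum (removeAt f (h zero) ∘ h′)   ≤⟨ +-monoʳ-≤ (f (h zero)) (sum-∘-injective-≤ _ h′ h′-inj) ⟩
  f (h zero) + sum (removeAt f (h zero))        ≡⟨ sum-remove f ⟨
  sum f                                         ∎
  where
  open ≤-Reasoning
  h₀≢ : ∀ a → h zero ≢ h (suc a)
  h₀≢ a = λ eq → contradiction (h-inj eq) λ ()
  h′ : Fin k → Fin n
  h′ a = punchOut (h₀≢ a)
  h′-inj : Injective _≡_ _≡_ h′
  h′-inj {a} {b} eq = suc-injective (h-inj (punchOut-injective (h₀≢ a) (h₀≢ b) eq))
  reindex : ∀ a → f (h (suc a)) ≡ removeAt f (h zero) (h′ a)
  reindex a = sym (removeAt-punchOut f (h₀≢ a))

cutIndicator : Graph n → Partition n → Fin n → Fin n → ℕ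
cutIndicator G p v u = if adj G v u ∧ (p u xor p v) then 1 else 0

cutDeg≡sum-cutIndicator : (G : Graph n) (p : Partition n) (v : Fin n) →
                          cutDeg G p v ≡ sum (cutIndicator G p v)
cutDeg≡sum-cutIndicator G p v = sum-map-allFin (cutIndicator G p v)

cutIndicator-cross : (G : Graph n) (p : Partition n) {u v : Fin n} →
                     adj G v u ≡ true → p u ≢ p v → cutIndicator G p v u ≡ 1
cutIndicator-cross G p {u} {v} vu pu≢pv rewrite vu | ¬-not pu≢pv with p v
... | true  = refl
... | false = refl

module _ {G : Graph n} (K : Clique G k) (p : Partition n) where

  cutIndicator-clique : ∀ {a c} → p (vert K a) ≢ p (vert K c) →
                        cutIndicator G p (vert K a) (vert K c) ≡ 1
  cutIndicator-clique {a} {c} pa≢pc =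
    cutIndicator-cross G p (pairwise K a c a≢c) (pa≢pc ∘ sym)
    where
    a≢c : a ≢ c
    a≢c refl = pa≢pc refl

  clique-covered-by-cut : ∀ {a b} → InV₁ p (vert K a) → InV₂ p (vert K b) → ∀ c →
    1 ≤ cutIndicator G p (vert K a) (vert K c) + cutIndicator G p (vert K b) (vert K c)
  clique-covered-by-cut {a} {b} a∈V₁ b∈V₂ c with p (vert K c) ≟ true
  ... | yes c∈V₂ = ≤-trans (≤-reflexive (sym (cutIndicator-clique λ eq → not-¬ a∈V₁ (trans eq c∈V₂))))
                           (m≤m+n _ _)
  ... | no  c∉V₂ = ≤-trans (≤-reflexive (sym (cutIndicator-clique λ eq → c∉V₂ (trans (sym eq) b∈V₂))))
                           (m≤n+m _ _)

  clique-size-≤-cutDeg : ∀ {a b} → InV₁ p (vert K a) → InV₂ p (vert K b) →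
                         k ≤ cutDeg G p (vert K a) + cutDeg G p (vert K b)
  clique-size-≤-cutDeg {a} {b} a∈V₁ b∈V₂ = begin
    k                                         ≡⟨ sum-ones k ⟨
    sum {k} (λ _ → 1)                         ≤⟨ sum-mono-≤ (clique-covered-by-cut a∈V₁ b∈V₂) ⟩
    sum (λ c → χ a (vert K c) + χ b (vert K c))  ≡⟨ ∑-distrib-+ (χ a ∘ vert K) (χ b ∘ vert K) ⟩
    sum (χ a ∘ vert K) + sum (χ b ∘ vert K)   ≤⟨ +-mono-≤ (sum-∘-injective-≤ (χ a) (vert K) vert-injective)
                                                          (sum-∘-injective-≤ (χ b) (vert K) vert-injective) ⟩
    sum (χ a) + sum (χ b)                     ≡⟨ cong₂ _+_ (cutDeg≡sum-cutIndicator G p (vert K a))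
                                                           (cutDeg≡sum-cutIndicator G p (vert K b)) ⟨
    cutDeg G p (vert K a) + cutDeg G p (vert K b)  ∎
    where
    open ≤-Reasoning
    χ : Fin k → Fin n → ℕ
    χ a = cutIndicator G p (vert K a)
    vert-injective : Injective _≡_ _≡_ (vert K)
    vert-injective = injective K _ _

constant-or-both-values : (f : Fin k → Bool) →
  (∀ a → f a ≡ false) ⊎ (∀ a → f a ≡ true) ⊎ (Σ[ a ∈ Fin k ] Σ[ b ∈ Fin k ] f a ≡ false × f b ≡ true)
constant-or-both-values {k} f with all? (λ a → f a ≟ false) | all? (λ a → f a ≟ true)
... | yes all-false | _            = inj₁ all-false
... | no _          | yes all-true = inj₂ (inj₁ all-true)
... | no ¬all-false | no ¬all-true
  with (a , fa≢true) ← ¬∀⟶∃¬ k _ (λ a → f a ≟ true) ¬all-true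
     | (b , fb≢false) ← ¬∀⟶∃¬ k _ (λ a → f a ≟ false) ¬all-false
  = inj₂ (inj₂ (a , b , ¬-not fa≢true , ¬-not fb≢false))

lemma1 : (i j k : ℕ) → 1 ≤ i → i ≤ j → i + j < k →
         {n : ℕ} (G : Graph n) (K : Clique G k) (p : Partition n) →
         IsFactorCut i j G p →
         ((a : Fin k) → InV₁ p (vert K a)) ⊎ ((a : Fin k) → InV₂ p (vert K a))
lemma1 i j k _ _ i+j<k G K p (V₁-bound , V₂-bound) with constant-or-both-values (p ∘ vert K)
... | inj₁ all-V₁        = inj₁ all-V₁
... | inj₂ (inj₁ all-V₂) = inj₂ all-V₂
... | inj₂ (inj₂ (a , b , a∈V₁ , b∈V₂)) = contradiction k≤i+j (<⇒≱ i+j<k)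
  where
  k≤i+j : k ≤ i + j
  k≤i+j = ≤-trans (clique-size-≤-cutDeg K p a∈V₁ b∈V₂)
                  (+-mono-≤ (V₁-bound _ a∈V₁) (V₂-bound _ b∈V₂))
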